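{- For every integer $k\geq 3$ with $k\not\equiv 0\pmod 8$, $\gamma(\overrightarrow{C_{3k}}\Box \overrightarrow{C_4}) = 3k+\left\lceil \frac{3k+1}{2}\right\rceil \neq 5k$. In particular, the formula $\gamma(\overrightarrow{C_{3k}}\Box \overrightarrow{C_n})=k(n+1)$ for all $k\geq 2$ and all $n\not\equiv 0\pmod 3$ is false.
   Context: For a digraph $D$, a vertex $u$ dominates $v$ if $u=v$ or $uv$ is an arc; $\gamma(D)$ is the minimum size of a set of vertices dominating every vertex. The directed cycle $\overrightarrow{C_n}$ has vertex set $\{0,\dots,n-1\}$ (integers mod $n$) and arcs $x\to x+1\pmod n$. The Cartesian product $D_1\Box D_2$ has vertex set $V_1\times V_2$ and an arc $(x_1,x_2)\to(y_1,y_2)$ iff either $x_1\to y_1$ is an arc of $D_1$ and $x_2=y_2$, or $x_2\to y_2$ is an arc of $D_2$ and $x_1=y_1$. -}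

module Defs where

open import Level using (0ℓ)
open import Data.Nat using (ℕ; zero; suc; _∸_; _≤_)
open import Data.Fin using (Fin; toℕ)
open import Data.Product using (_×_; _,_; ∃)
open import Data.Sum using (_⊎_)
open import Data.List using (List; length)
open import Data.List.Relation.Unary.Any using (Any)
open import Data.List.Relation.Unary.Unique.Propositional using (Unique)
open import Relation.Binary.PropositionalEquality using (_≡_)

record Digraph : Set₁ where
  field
    V   : Set
    Arc : V → V → Set
open Digraph public

Dominates : (D : Digraph) → V D → V D → Set
Dominates D u v = (u ≡ v) ⊎ Arc D u v

Dominating : (D : Digraph) → List (V D) → Set
Dominating D S = ∀ v → Any (λ u → Dominates D u v) S

IsDominationNumber : (D : Digraph) → ℕ → Set
IsDominationNumber D g =
  (∃ λ (S : List (V D)) → Unique S × Dominating D S × length S ≡ g)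
  × (∀ (S : List (V D)) → Unique S → Dominating D S → g ≤ length S)

DiCycle : ℕ → Digraph
DiCycle n = record
  { V = Fin n
  ; Arc = λ x y → (toℕ y ≡ suc (toℕ x)) ⊎ ((toℕ x ≡ n ∸ 1) × (toℕ y ≡ 0)) }

_□_ : Digraph → Digraph → Digraph
D₁ □ D₂ = record
  { V = V D₁ × V D₂
  ; Arc = λ { (x₁ , x₂) (y₁ , y₂) →
      (Arc D₁ x₁ y₁ × x₂ ≡ y₂) ⊎ (Arc D₂ x₂ y₂ × x₁ ≡ y₁) } }

module Submission where

-- We prove the general statement γ(C_m □ C_4) = m + ⌈(m + 1)/2⌉ for 8 ∤ m.
-- A vertex set of C_m □ C_4 is read column by column, a column being the set
-- of occupied rows (one of 16 bit vectors).  The set dominates exactly when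
-- each column, together with the column before it, dominates all cells of the
-- column ('Covers'); so dominating sets are closed walks of columns ('Walk').
-- Lower bound, by discharging: with a suitable potential every step of a walk
-- costs at least 3/2 cells, and the only steps attaining 3/2 go around one
-- fixed cycle of 8 columns, so a closed walk of length m with 8 ∤ m has more
-- than 3m/2 cells.  Upper bound: that 8-cycle repeated, followed by one of
-- seven short walks, yields closed walks of every length m with exactly
-- m + ⌈(m + 1)/2⌉ cells.  The theorem is the case m = 3k; k = 3 gives 14 ≠ 15.

open import Defs
open import Data.Nat using (ℕ; zero; suc; _+_; _*_; _%_; _≤_; _<_; _≥_; z≤n; s≤s; s≤s⁻¹; s<s; ⌈_/2⌉; NonZero; _≤?_)
open import Data.Nat.Properties
open import Data.Nat.DivMod using (%-distribˡ-+; [m+n]%n≡m%n; [m+kn]%n≡m%n; m*n%n≡0)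
open import Data.Nat.Divisibility using (m%n≡0⇒n∣m; n∣m⇒m%n≡0)
open import Data.Nat.Coprimality using (coprime?; coprime-divisor)
open import Data.Nat.Solver using (module +-*-Solver)
open +-*-Solver using (solve; _:=_; _:+_; _:*_; con)
open import Data.Bool using (Bool; true; false; T)
import Data.Bool.Properties as Bool
open import Data.Fin using (Fin; zero; suc; fromℕ; inject₁)
import Data.Fin.Properties as Fin
open import Data.Vec using (Vec; []; _∷_; lookup; tabulate; _++_; sum; map)
open import Data.Vec.Properties using (lookup∘tabulate; tabulate∘lookup; sum-++; map-++)
import Data.Vec.Properties as Vec
open import Data.List using (List; []; _∷_; length; filter; cartesianProduct; allFin)
import Data.List as L
open import Data.List.Properties using (filter-++; length-++; filter-all)
open import Data.List.Membership.Propositional using (_∈_; find; lose)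
open import Data.List.Membership.Propositional.Properties
  using (∈-filter⁺; ∈-filter⁻; ∈-cartesianProduct⁺; ∈-allFin)
import Data.List.Membership.DecPropositional as DecMembership
open import Data.List.Relation.Unary.Any using (here; there)
import Data.List.Relation.Unary.All as All
open import Data.List.Relation.Unary.AllPairs using ([]; _∷_)
open import Data.List.Relation.Unary.Unique.Propositional using (Unique)
open import Data.List.Relation.Unary.Unique.Propositional.Properties using (filter⁺; cartesianProduct⁺; allFin⁺)
open import Data.List.Relation.Binary.Subset.Propositional using (_⊆_)
open import Data.Product using (_×_; _,_; proj₁; proj₂; Σ; ∃)
open import Data.Product.Properties using (≡-dec)
open import Data.Sum using (_⊎_; inj₁; inj₂)
open import Function using (_∘_)
open import Relation.Nullary using (¬_; Dec; yes; no; does; contradiction)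
open import Relation.Nullary.Decidable
  using (map′; from-yes; True; toWitness; fromWitness; isYes; T?; ¬?; _×-dec_; _→-dec_; _⊎-dec_)
open import Relation.Binary.Definitions using (DecidableEquality)
open import Relation.Binary.PropositionalEquality
  using (_≡_; _≢_; ≢-sym; refl; sym; trans; cong; cong₂; subst; subst₂; module ≡-Reasoning)

Bound : ℕ → ℕ → Set → Set
Bound x y P = x ≤ y × (x ≡ y → P)

bound-+ : ∀ {a b c d} {P Q : Set} → Bound a b P → Bound c d Q → Bound (a + c) (b + d) (P × Q)
bound-+ {a} {b} {c} {d} (a≤b , tight₁) (c≤d , tight₂) = +-mono-≤ a≤b c≤d , tight
  where
  tight : a + c ≡ b + d → _
  tight eq with m≤n⇒m<n∨m≡n a≤b
  ... | inj₁ a<b = contradiction eq (<⇒≢ (+-mono-<-≤ a<b c≤d))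
  ... | inj₂ refl = tight₁ refl , tight₂ (+-cancelˡ-≡ a c d eq)

bound-resp : ∀ {x x′ y y′} {P Q : Set} → x ≡ x′ → y ≡ y′ → (P → Q) → Bound x y P → Bound x′ y′ Q
bound-resp refl refl f (le , tight) = le , f ∘ tight

bound-cancelʳ : ∀ {x y} {P : Set} z → Bound (x + z) (y + z) P → Bound x y P
bound-cancelʳ {x} {y} z (le , tight) = +-cancelʳ-≤ z x y le , λ eq → tight (cong (_+ z) eq)

%-cong-+ʳ : ∀ {d} .{{_ : NonZero d}} x y n → x % d ≡ y % d → (x + n) % d ≡ (y + n) % d
%-cong-+ʳ {d} x y n eq = begin
  (x + n) % d              ≡⟨ %-distribˡ-+ x n d ⟩
  (x % d + n % d) % d      ≡⟨ cong (λ r → (r + n % d) % d) eq ⟩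
  (y % d + n % d) % d      ≡⟨ sym (%-distribˡ-+ y n d) ⟩
  (y + n) % d              ∎
  where open ≡-Reasoning

%-cancel-+ˡ : ∀ d .{{_ : NonZero d}} x m → (x + m) % d ≡ x % d → m % d ≡ 0
%-cancel-+ˡ (suc d) x m eq = begin
  m % suc d                    ≡⟨ sym ([m+kn]%n≡m%n m x (suc d)) ⟩
  (m + x * suc d) % suc d      ≡⟨ cong (_% suc d) (solve 3 (λ m x d → m :+ x :* (con 1 :+ d) := (x :+ m) :+ x :* d) refl m x d) ⟩
  ((x + m) + x * d) % suc d    ≡⟨ %-cong-+ʳ (x + m) x (x * d) eq ⟩
  (x + x * d) % suc d          ≡⟨ cong (_% suc d) (sym (*-suc x d)) ⟩
  (x * suc d) % suc d          ≡⟨ m*n%n≡0 x (suc d) ⟩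
  0                            ∎
  where open ≡-Reasoning

double-⌈/2⌉ : ∀ n → 2 * ⌈ n /2⌉ ≤ suc n
double-⌈/2⌉ zero = z≤n
double-⌈/2⌉ (suc zero) = ≤-refl
double-⌈/2⌉ (suc (suc n)) rewrite *-suc 2 ⌈ n /2⌉ = s≤s (s≤s (double-⌈/2⌉ n))

module _ {A : Set} (_≟_ : DecidableEquality A) where

  without : A → List A → List A
  without y = filter (λ x → ¬? (x ≟ y))

  length-without : ∀ y {xs} → Unique xs → length xs ≤ suc (length (without y xs))
  length-without y {[]} [] = z≤n
  length-without y {x ∷ xs} (x∉xs ∷ unique) with x ≟ y
  ... | yes refl = s≤s (≤-reflexive (sym (cong length (filter-all (λ z → ¬? (z ≟ y)) (All.map ≢-sym x∉xs)))))
  ... | no _ = s≤s (length-without y unique)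

  unique-⊆⇒length≤ : ∀ {xs} ys → Unique xs → xs ⊆ ys → length xs ≤ length ys
  unique-⊆⇒length≤ {[]} ys _ _ = z≤n
  unique-⊆⇒length≤ {x ∷ xs} [] _ sub with sub (here refl)
  ... | ()
  unique-⊆⇒length≤ {xs} (y ∷ ys) unique sub =
    ≤-trans (length-without y unique) (s≤s (unique-⊆⇒length≤ ys (filter⁺ _ unique) sub′))
    where
    sub′ : without y xs ⊆ ys
    sub′ z∈ with ∈-filter⁻ (λ x → ¬? (x ≟ y)) z∈
    ... | z∈xs , z≢y with sub z∈xs
    ...   | here z≡y = contradiction z≡y z≢y
    ...   | there z∈ys = z∈ys

∀-Bool? : {P : Bool → Set} → (∀ b → Dec (P b)) → Dec (∀ b → P b)
∀-Bool? P? = map′ (λ (f , t) → λ { false → f ; true → t }) (λ h → h false , h true) (P? false ×-dec P? true)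

∀-Vec? : ∀ n {P : Vec Bool n → Set} → (∀ v → Dec (P v)) → Dec (∀ v → P v)
∀-Vec? zero P? = map′ (λ p → λ { [] → p }) (λ h → h []) (P? [])
∀-Vec? (suc n) P? = map′ (λ h → λ { (b ∷ v) → h b v }) (λ h b v → h (b ∷ v)) (∀-Bool? λ b → ∀-Vec? n λ v → P? (b ∷ v))

prv : ∀ {n} → Fin (suc n) → Fin (suc n)
prv {n} zero = fromℕ n
prv (suc i) = inject₁ i

arc-prv : ∀ {n} (b : Fin (suc n)) → Arc (DiCycle (suc n)) (prv b) b
arc-prv {n} zero = inj₂ (Fin.toℕ-fromℕ n , refl)
arc-prv (suc i) = inj₁ (cong suc (sym (Fin.toℕ-inject₁ i)))

arc⇒prv : ∀ {n} {a b : Fin (suc n)} → Arc (DiCycle (suc n)) a b → a ≡ prv b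
arc⇒prv {b = zero} (inj₁ ())
arc⇒prv {b = suc i} (inj₁ e) = Fin.toℕ-injective (trans (suc-injective (sym e)) (sym (Fin.toℕ-inject₁ i)))
arc⇒prv {n} {b = zero} (inj₂ (a≡n , _)) = Fin.toℕ-injective (trans a≡n (sym (Fin.toℕ-fromℕ n)))
arc⇒prv {b = suc i} (inj₂ (_ , ()))

-- A column of C_m □ C_4: the set of occupied rows, as a bit vector.
Column : Set
Column = Vec Bool 4

_≟ᶜ_ : DecidableEquality Column
_≟ᶜ_ = Vec.≡-dec Bool._≟_

size : Column → ℕ
size c = length (filter (λ y → T? (lookup c y)) (allFin 4))

-- The column b is fully dominated when its predecessor column is a: every
-- cell (x , y) is occupied, or dominated from below by (x , y - 1), or
-- from the left by (x - 1 , y).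
Covers : Column → Column → Set
Covers a b = ∀ y → T (lookup b y) ⊎ T (lookup b (prv y)) ⊎ T (lookup a y)

covers? : ∀ a b → Dec (Covers a b)
covers? a b = Fin.all? λ y → T? (lookup b y) ⊎-dec T? (lookup b (prv y)) ⊎-dec T? (lookup a y)

∀-Column? : {P : Column → Set} → (∀ c → Dec (P c)) → Dec (∀ c → P c)
∀-Column? = ∀-Vec? 4

data Walk : ∀ {n} → Column → Vec Column n → Column → Set where
  [] : ∀ {a} → Walk a [] a
  _∷_ : ∀ {n a x b} {v : Vec Column n} → Covers a x → Walk x v b → Walk a (x ∷ v) b

walk? : ∀ {n} a (v : Vec Column n) b → Dec (Walk a v b)
walk? a [] b = map′ (λ { refl → [] }) (λ { [] → refl }) (a ≟ᶜ b)
walk? a (x ∷ v) b = map′ (λ (c , w) → c ∷ w) (λ { (c ∷ w) → c , w }) (covers? a x ×-dec walk? x v b)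

_++ʷ_ : ∀ {m n a b c} {u : Vec Column m} {v : Vec Column n} → Walk a u b → Walk b v c → Walk a (u ++ v) c
[] ++ʷ w = w
(c ∷ w) ++ʷ w′ = c ∷ (w ++ʷ w′)

total : ∀ {n} → Vec Column n → ℕ
total v = sum (map size v)

total-++ : ∀ {m n} (u : Vec Column m) (v : Vec Column n) → total (u ++ v) ≡ total u + total v
total-++ u v = trans (cong sum (map-++ size u v)) (sum-++ (map size u))

Cyclic : ∀ {n} → (Fin (suc n) → Column) → Set
Cyclic g = ∀ x → Covers (g (prv x)) (g x)

chain⇒walk : ∀ {n} (g : Fin (suc n) → Column) → (∀ i → Covers (g (inject₁ i)) (g (suc i))) →
             Walk (g zero) (tabulate (g ∘ suc)) (g (fromℕ n))
chain⇒walk {zero} g _ = []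
chain⇒walk {suc n} g step = step zero ∷ chain⇒walk (g ∘ suc) (step ∘ suc)

cyclic⇒walk : ∀ {n} {g : Fin (suc n) → Column} → Cyclic g → Walk (g (fromℕ n)) (tabulate g) (g (fromℕ n))
cyclic⇒walk {g = g} cyclic = cyclic zero ∷ chain⇒walk g (cyclic ∘ suc)

walk-steps : ∀ {n a b} {v : Vec Column (suc n)} → Walk a v b → ∀ i → Covers (lookup v (inject₁ i)) (lookup v (suc i))
walk-steps (_ ∷ (c ∷ _)) zero = c
walk-steps (_ ∷ w@(_ ∷ _)) (suc i) = walk-steps w i

walk-end : ∀ {n a b} {v : Vec Column (suc n)} → Walk a v b → lookup v (fromℕ n) ≡ b
walk-end (_ ∷ []) = refl
walk-end (_ ∷ w@(_ ∷ _)) = walk-end w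

walk⇒cyclic : ∀ {n s} {v : Vec Column (suc n)} → Walk s v s → Cyclic (lookup v)
walk⇒cyclic {v = x ∷ _} w@(c ∷ _) zero = subst (λ a → Covers a x) (sym (walk-end w)) c
walk⇒cyclic w (suc i) = walk-steps w i

length-filter-map : ∀ {A B : Set} (f : A → B) {P : B → Set} (P? : ∀ b → Dec (P b)) xs →
                    length (filter P? (L.map f xs)) ≡ length (filter (P? ∘ f) xs)
length-filter-map f P? [] = refl
length-filter-map f P? (x ∷ xs) with does (P? (f x))
... | true = cong suc (length-filter-map f P? xs)
... | false = length-filter-map f P? xs

module Torus (n : ℕ) where

  Grid : Digraph
  Grid = DiCycle (suc n) □ DiCycle 4

  Vertex : Set
  Vertex = Fin (suc n) × Fin 4

  occupied? : (g : Fin (suc n) → Column) → ∀ v → Dec (T (lookup (g (proj₁ v)) (proj₂ v)))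
  occupied? g (x , y) = T? (lookup (g x) y)

  vertices : List Vertex
  vertices = cartesianProduct (allFin (suc n)) (allFin 4)

  cells : (Fin (suc n) → Column) → List Vertex
  cells g = filter (occupied? g) vertices

  cells-unique : ∀ g → Unique (cells g)
  cells-unique g = filter⁺ (occupied? g) (cartesianProduct⁺ (allFin⁺ (suc n)) (allFin⁺ 4))

  ∈-cells : ∀ g {x y} → T (lookup (g x) y) → (x , y) ∈ cells g
  ∈-cells g {x} {y} = ∈-filter⁺ (occupied? g) (∈-cartesianProduct⁺ (∈-allFin x) (∈-allFin y))

  length-cells′ : ∀ (g : Fin (suc n) → Column) {k} (f : Fin k → Fin (suc n)) →
    length (filter (occupied? g) (cartesianProduct (L.tabulate f) (allFin 4))) ≡ total (tabulate (g ∘ f))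
  length-cells′ g {zero} f = refl
  length-cells′ g {suc k} f = begin
      length (filter P? (column ++ᴸ rest))
    ≡⟨ cong length (filter-++ P? column rest) ⟩
      length (filter P? column ++ᴸ filter P? rest)
    ≡⟨ length-++ (filter P? column) ⟩
      length (filter P? column) + length (filter P? rest)
    ≡⟨ cong₂ _+_ (length-filter-map (f zero ,_) P? (allFin 4)) (length-cells′ g (f ∘ suc)) ⟩
      size (g (f zero)) + total (tabulate (g ∘ f ∘ suc))
    ∎
    where
    open ≡-Reasoning
    open L using () renaming (_++_ to _++ᴸ_)
    P? = occupied? g
    column = L.map (f zero ,_) (allFin 4)
    rest = cartesianProduct (L.tabulate (f ∘ suc)) (allFin 4)

  length-cells : ∀ g → length (cells g) ≡ total (tabulate g)
  length-cells g = length-cells′ g (λ x → x)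

  cells-dominating : ∀ g → Cyclic g → Dominating Grid (cells g)
  cells-dominating g cyclic (x , y) with cyclic x y
  ... | inj₁ self = lose (∈-cells g self) (inj₁ refl)
  ... | inj₂ (inj₁ below) = lose (∈-cells g below) (inj₂ (inj₂ (arc-prv y , refl)))
  ... | inj₂ (inj₂ left) = lose (∈-cells g left) (inj₂ (inj₁ (arc-prv x , refl)))

  _≟ᵛ_ : DecidableEquality Vertex
  _≟ᵛ_ = ≡-dec Fin._≟_ Fin._≟_

  open DecMembership _≟ᵛ_ using (_∈?_)

  colOf : List Vertex → Fin (suc n) → Column
  colOf S x = tabulate (λ y → isYes ((x , y) ∈? S))

  ∈⇒occupied : ∀ {S x y} → (x , y) ∈ S → T (lookup (colOf S x) y)
  ∈⇒occupied {S} {x} {y} x,y∈S = subst T (sym (lookup∘tabulate (λ y → isYes ((x , y) ∈? S)) y)) (fromWitness x,y∈S)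

  occupied⇒∈ : ∀ {S x y} → T (lookup (colOf S x) y) → (x , y) ∈ S
  occupied⇒∈ {S} {x} {y} t = toWitness (subst T (lookup∘tabulate (λ y → isYes ((x , y) ∈? S)) y) t)

  dominating⇒cyclic : ∀ S → Dominating Grid S → Cyclic (colOf S)
  dominating⇒cyclic S dom x y with find (dom (x , y))
  ... | _ , u∈S , inj₁ refl = inj₁ (∈⇒occupied u∈S)
  ... | _ , u∈S , inj₂ (inj₁ (arc , refl)) with refl ← arc⇒prv arc = inj₂ (inj₂ (∈⇒occupied u∈S))
  ... | _ , u∈S , inj₂ (inj₂ (arc , refl)) with refl ← arc⇒prv arc = inj₂ (inj₁ (∈⇒occupied u∈S))

  total-colOf : ∀ S → total (tabulate (colOf S)) ≤ length S
  total-colOf S = begin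
    total (tabulate (colOf S)) ≡⟨ sym (length-cells (colOf S)) ⟩
    length (cells (colOf S))   ≤⟨ unique-⊆⇒length≤ _≟ᵛ_ S (cells-unique (colOf S)) within ⟩
    length S                   ∎
    where
    open ≤-Reasoning
    within : cells (colOf S) ⊆ S
    within v∈ = occupied⇒∈ (proj₂ (∈-filter⁻ (occupied? (colOf S)) {xs = vertices} v∈))

pattern c∅    = false ∷ false ∷ false ∷ false ∷ []
pattern c0    = true  ∷ false ∷ false ∷ false ∷ []
pattern c1    = false ∷ true  ∷ false ∷ false ∷ []
pattern c2    = false ∷ false ∷ true  ∷ false ∷ []
pattern c3    = false ∷ false ∷ false ∷ true  ∷ []
pattern c01   = true  ∷ true  ∷ false ∷ false ∷ []
pattern c02   = true  ∷ false ∷ true  ∷ false ∷ []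
pattern c03   = true  ∷ false ∷ false ∷ true  ∷ []
pattern c12   = false ∷ true  ∷ true  ∷ false ∷ []
pattern c13   = false ∷ true  ∷ false ∷ true  ∷ []
pattern c23   = false ∷ false ∷ true  ∷ true  ∷ []
pattern c012  = true  ∷ true  ∷ true  ∷ false ∷ []
pattern c013  = true  ∷ true  ∷ false ∷ true  ∷ []
pattern c023  = true  ∷ false ∷ true  ∷ true  ∷ []
pattern c123  = false ∷ true  ∷ true  ∷ true  ∷ []
pattern c0123 = true  ∷ true  ∷ true  ∷ true  ∷ []

-- A potential on columns: passing from a to a column b covered by a costs
-- 32 · size b + potential a - potential b ≥ 48, i.e. 3/2 cells per column
-- on average (see step-bound).
potential : Column → ℕ
potential c∅    = 28
potential c0    = 0
potential c1    = 0
potential c2    = 0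
potential c3    = 0
potential c01   = 16
potential c02   = 14
potential c03   = 16
potential c12   = 16
potential c13   = 14
potential c23   = 16
potential c012  = 46
potential c013  = 46
potential c023  = 46
potential c123  = 46
potential c0123 = 78

-- The position of a column in the cycle c0 → c12 → c3 → c01 → c2 → c03 →
-- c1 → c23 → c0, which consists of the only steps attaining the bound.
phase : Column → ℕ
phase c0  = 0
phase c12 = 1
phase c3  = 2
phase c01 = 3
phase c2  = 4
phase c03 = 5
phase c1  = 6
phase c23 = 7
phase _   = 0

step-bound : ∀ a b → Covers a b →
  Bound (48 + potential b) (32 * size b + potential a) (suc (phase a) % 8 ≡ phase b % 8)
step-bound = from-yes (∀-Column? λ a → ∀-Column? λ b → covers? a b →-dec
  ((48 + potential b ≤? 32 * size b + potential a) ×-dec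
   ((48 + potential b ≟ 32 * size b + potential a) →-dec (suc (phase a) % 8 ≟ phase b % 8))))

-- Summing the step bounds along a walk: the potential telescopes and the
-- phase advances by one at every tight step.
walk-bound : ∀ {n a b} {v : Vec Column n} → Walk a v b →
  Bound (48 * n + potential b) (32 * total v + potential a) ((phase a + n) % 8 ≡ phase b % 8)
walk-bound {a = a} [] = ≤-refl , λ _ → cong (_% 8) (+-identityʳ (phase a))
walk-bound {suc n} {a} {b} (_∷_ {x = x} {v = v} covers walk) =
  bound-cancelʳ (potential x) (bound-resp lhs rhs advance (bound-+ (step-bound a x covers) (walk-bound walk)))
  where
  lhs : (48 + potential x) + (48 * n + potential b) ≡ (48 * suc n + potential b) + potential x
  lhs = solve 3 (λ n φx φb → (con 48 :+ φx) :+ (con 48 :* n :+ φb) := (con 48 :* (con 1 :+ n) :+ φb) :+ φx)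
          refl n (potential x) (potential b)
  rhs : (32 * size x + potential a) + (32 * total v + potential x) ≡ (32 * (size x + total v) + potential a) + potential x
  rhs = solve 4 (λ s t φa φx → (con 32 :* s :+ φa) :+ (con 32 :* t :+ φx) := (con 32 :* (s :+ t) :+ φa) :+ φx)
          refl (size x) (total v) (potential a) (potential x)
  advance : (suc (phase a) % 8 ≡ phase x % 8) × ((phase x + n) % 8 ≡ phase b % 8) → (phase a + suc n) % 8 ≡ phase b % 8
  advance (step , rest) = begin
    (phase a + suc n) % 8   ≡⟨ cong (_% 8) (+-suc (phase a) n) ⟩
    (suc (phase a) + n) % 8 ≡⟨ %-cong-+ʳ (suc (phase a)) (phase x) n step ⟩
    (phase x + n) % 8       ≡⟨ rest ⟩
    phase b % 8             ∎
    where open ≡-Reasoning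

-- Around a closed walk whose length is not a multiple of 8 some step is
-- strict, so such a walk has more than 3/2 occupied cells per column.
closed-walk-bound : ∀ {n s} {v : Vec Column n} → Walk s v s → n % 8 ≢ 0 → 3 * n < 2 * total v
closed-walk-bound {n} {s} {v} walk n≢0 = *-cancelˡ-< 16 (3 * n) (2 * total v) (subst₂ _<_ (*-assoc 16 3 n) (*-assoc 16 2 (total v)) strict)
  where
  bound : Bound (48 * n) (32 * total v) (n % 8 ≡ 0)
  bound = bound-resp refl refl (%-cancel-+ˡ 8 (phase s) n) (bound-cancelʳ (potential s) (walk-bound walk))
  strict : 48 * n < 32 * total v
  strict = ≤∧≢⇒< (proj₁ bound) (n≢0 ∘ proj₂ bound)

optimum : ℕ → ℕ
optimum m = m + ⌈ m + 1 /2⌉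

optimum-≤ : ∀ m W → 3 * m < 2 * W → optimum m ≤ W
optimum-≤ m W 3m<2W = s≤s⁻¹ (*-cancelˡ-< 2 (optimum m) (suc W) (begin-strict
    2 * optimum m              ≡⟨ *-distribˡ-+ 2 m ⌈ m + 1 /2⌉ ⟩
    2 * m + 2 * ⌈ m + 1 /2⌉    ≤⟨ +-monoʳ-≤ (2 * m) (double-⌈/2⌉ (m + 1)) ⟩
    2 * m + suc (m + 1)        ≡⟨ solve 1 (λ m → con 2 :* m :+ (con 1 :+ (m :+ con 1)) := con 2 :+ con 3 :* m) refl m ⟩
    suc (suc (3 * m))          <⟨ s<s (s<s 3m<2W) ⟩
    suc (suc (2 * W))          ≡⟨ sym (*-suc 2 W) ⟩
    2 * suc W                  ∎))
  where open ≤-Reasoning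

lower-bound : ∀ {n} (S : List (V (DiCycle (suc n) □ DiCycle 4))) →
              Dominating (DiCycle (suc n) □ DiCycle 4) S → suc n % 8 ≢ 0 → optimum (suc n) ≤ length S
lower-bound {n} S dom 8∤m =
  ≤-trans (optimum-≤ (suc n) _ (closed-walk-bound (cyclic⇒walk {g = colOf S} (dominating⇒cyclic S dom)) 8∤m)) (total-colOf S)
  where open Torus n

upper-bound : ∀ {n s} {v : Vec Column (suc n)} → Walk s v s →
  ∃ λ (S : List (V (DiCycle (suc n) □ DiCycle 4))) →
    Unique S × Dominating (DiCycle (suc n) □ DiCycle 4) S × length S ≡ total v
upper-bound {n} {v = v} walk =
  cells g , cells-unique g , cells-dominating g (walk⇒cyclic walk) , trans (length-cells g) (cong total (tabulate∘lookup v))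
  where
  open Torus n
  g = lookup v

OptimalLoop : ℕ → Set
OptimalLoop m = Σ (Vec Column m) λ v → Walk c23 v c23 × total v ≡ optimum m

-- The tight cycle of phases 0, …, 7, traversed once: 12 cells on 8 columns.
block : Vec Column 8
block = c0 ∷ c12 ∷ c3 ∷ c01 ∷ c2 ∷ c03 ∷ c1 ∷ c23 ∷ []

optimum-+8 : ∀ m → optimum (8 + m) ≡ 12 + optimum m
optimum-+8 m = solve 2 (λ m c → (con 8 :+ m) :+ (con 4 :+ c) := con 12 :+ (m :+ c)) refl m ⌈ m + 1 /2⌉

block-walk : Walk c23 block c23
block-walk = from-yes (walk? c23 block c23)

prepend-block : ∀ {m} → OptimalLoop m → OptimalLoop (8 + m)
prepend-block {m} (v , walk , total≡) =
  block ++ v , block-walk ++ʷ walk ,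
  trans (total-++ block v) (trans (cong (12 +_) total≡) (sym (optimum-+8 m)))

checked-loop : ∀ {m} (v : Vec Column m) → {True (walk? c23 v c23)} → {True (total v ≟ optimum m)} → OptimalLoop m
checked-loop v {walk} {total≡} = v , toWitness walk , toWitness total≡

-- Loops of every length m ≥ 2 with 8 ∤ m: for m = 2, …, 7, 9 explicit ones
-- (parts of the tight cycle, with the slack spent on copies of c13), and for
-- longer m the loop for m - 8 with the tight cycle prepended.
optimal-loop : ∀ m → (2 + m) % 8 ≢ 0 → OptimalLoop (2 + m)
optimal-loop 0 _ = checked-loop (c13 ∷ c23 ∷ [])
optimal-loop 1 _ = checked-loop (c0 ∷ c13 ∷ c23 ∷ [])
optimal-loop 2 _ = checked-loop (c0 ∷ c13 ∷ c13 ∷ c23 ∷ [])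
optimal-loop 3 _ = checked-loop (c0 ∷ c12 ∷ c3 ∷ c13 ∷ c23 ∷ [])
optimal-loop 4 _ = checked-loop (c13 ∷ c01 ∷ c2 ∷ c03 ∷ c1 ∷ c23 ∷ [])
optimal-loop 5 _ = checked-loop (c0 ∷ c13 ∷ c01 ∷ c2 ∷ c03 ∷ c1 ∷ c23 ∷ [])
optimal-loop 6 8∤8 = contradiction refl 8∤8
optimal-loop 7 _ = checked-loop (c0 ∷ c12 ∷ c3 ∷ c13 ∷ c01 ∷ c2 ∷ c03 ∷ c1 ∷ c23 ∷ [])
optimal-loop (suc (suc (suc (suc (suc (suc (suc (suc m)))))))) 8∤m = prepend-block (optimal-loop m (8∤m ∘ shift))
  where
  shift : (2 + m) % 8 ≡ 0 → (8 + (2 + m)) % 8 ≡ 0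
  shift 8∣2+m = trans (trans (cong (_% 8) (+-comm 8 (2 + m))) ([m+n]%n≡m%n (2 + m) 8)) 8∣2+m

optimal-walk : ∀ m → m % 8 ≢ 0 → Σ (Vec Column m) λ v → Σ Column λ s → Walk s v s × total v ≡ optimum m
optimal-walk 0 8∤0 = contradiction refl 8∤0
optimal-walk 1 _ = c02 ∷ [] , c02 , from-yes (walk? c02 (c02 ∷ []) c02) , refl
optimal-walk (suc (suc m)) 8∤m = let (v , walk , total≡) = optimal-loop m 8∤m in v , c23 , walk , total≡

domination-number : ∀ m → m % 8 ≢ 0 → IsDominationNumber (DiCycle m □ DiCycle 4) (optimum m)
domination-number 0 8∤0 = contradiction refl 8∤0
domination-number (suc n) 8∤m =
  let (v , s , walk , total≡) = optimal-walk (suc n) 8∤m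
      (S , unique , dom , length≡) = upper-bound walk
  in (S , unique , dom , trans length≡ total≡) , λ S _ dom → lower-bound S dom 8∤m

domination-number-unique : ∀ {D g h} → IsDominationNumber D g → IsDominationNumber D h → g ≡ h
domination-number-unique ((S , unique , dom , refl) , minimal-g) ((S′ , unique′ , dom′ , refl) , minimal-h) =
  ≤-antisym (minimal-g S′ unique′ dom′) (minimal-h S unique dom)

-- Since gcd(3, 8) = 1, 8 ∣ 3k only if 8 ∣ k.
8∤3k : ∀ k → k % 8 ≢ 0 → 3 * k % 8 ≢ 0
8∤3k k 8∤k 8∣3k = 8∤k (n∣m⇒m%n≡0 k 8 (coprime-divisor (from-yes (coprime? 8 3)) (m%n≡0⇒n∣m (3 * k) 8 8∣3k)))

optimum-3k≢5k : ∀ k → k ≥ 3 → optimum (3 * k) ≢ 5 * k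
optimum-3k≢5k k k≥3 eq = <⇒≱ k≥3 (+-cancelˡ-≤ (3 * k) k 2 (begin
    3 * k + k              ≡⟨ solve 1 (λ k → con 3 :* k :+ k := con 2 :* (con 2 :* k)) refl k ⟩
    2 * (2 * k)            ≡⟨ cong (2 *_) (sym half) ⟩
    2 * ⌈ 3 * k + 1 /2⌉    ≤⟨ double-⌈/2⌉ (3 * k + 1) ⟩
    suc (3 * k + 1)        ≡⟨ solve 1 (λ k → con 1 :+ (con 3 :* k :+ con 1) := con 3 :* k :+ con 2) refl k ⟩
    3 * k + 2              ∎))
  where
  open ≤-Reasoning
  half : ⌈ 3 * k + 1 /2⌉ ≡ 2 * k
  half = +-cancelˡ-≡ (3 * k) _ _ (trans eq (solve 1 (λ k → con 5 :* k := con 3 :* k :+ con 2 :* k) refl k))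

mainTheorem6 :
    (∀ (k : ℕ) → k ≥ 3 → k % 8 ≢ 0 →
      IsDominationNumber (DiCycle (3 * k) □ DiCycle 4) (3 * k + ⌈ 3 * k + 1 /2⌉)
      × (3 * k + ⌈ 3 * k + 1 /2⌉ ≢ 5 * k))
    × ¬ (∀ (k n : ℕ) → k ≥ 2 → n ≥ 2 → n % 3 ≢ 0 →
          IsDominationNumber (DiCycle (3 * k) □ DiCycle n) (k * (n + 1)))
mainTheorem6 = (λ k k≥3 8∤k → domination-number (3 * k) (8∤3k k 8∤k) , optimum-3k≢5k k k≥3) , refute
  where
  -- For k = 3 and n = 4 the formula predicts 15, but γ(C_9 □ C_4) = 14.
  refute : ¬ (∀ (k n : ℕ) → k ≥ 2 → n ≥ 2 → n % 3 ≢ 0 →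
              IsDominationNumber (DiCycle (3 * k) □ DiCycle n) (k * (n + 1)))
  refute formula = 14≢15 (domination-number-unique (domination-number 9 (λ ())) (formula 3 4 (s≤s (s≤s z≤n)) (s≤s (s≤s z≤n)) (λ ())))
    where
    14≢15 : 14 ≢ 15
    14≢15 ()
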